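{- For all $\phi,\psi\in\mathcal{L}$: if $\vdash\phi\le\psi$ then $\models\phi\le\psi$.
   Context: A quasi-applicative transition system (quasi-ats) is $(A,ev)$ with $ev:A\rightharpoonup(A\to A)$ partial; write $a\Downarrow f$ if $ev(a)=f$. The domain logic $\mathcal{L}$ has syntax $\phi::=t\mid\phi\wedge\psi\mid(\phi\to\psi)_\bot$ ($t$ = true). Satisfaction in a quasi-ats: $a\models t$ always; $a\models\phi\wedge\psi$ iff $a\models\phi$ and $a\models\psi$; $a\models(\phi\to\psi)_\bot$ iff $a\Downarrow f$ and for all $b\in A$, $b\models\phi$ implies $f(b)\models\psi$. $\models\phi\le\psi$ means that in every quasi-ats every element satisfying $\phi$ satisfies $\psi$. The proof system $\vdash$: reflexivity and transitivity of $\le$; $\phi=\psi$ iff $\phi\le\psi$ and $\psi\le\phi$; $\phi\le t$; $\wedge$-introduction and elimination; if $\phi_2\le\phi_1$ and $\psi_1\le\psi_2$ then $(\phi_1\to\psi_1)_\bot\le(\phi_2\to\psi_2)_\bot$; $(\phi\to\psi_1\wedge\psi_2)_\bot=(\phi\to\psi_1)_\bot\wedge(\phi\to\psi_2)_\bot$; $(\phi\to t)_\bot\le(t\to t)_\bot$. -}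

module Defs where

open import Level using (Level; suc; zero)
open import Data.Maybe using (Maybe; just; nothing)
open import Data.Product using (_×_; Σ; _,_)
open import Data.Unit.Polymorphic using (⊤)
open import Relation.Binary.PropositionalEquality using (_≡_)

-- Quasi-applicative transition system: a carrier A with a partial map
-- ev : A ⇀ (A → A), modelled as A → Maybe (A → A).
record QATS (ℓ : Level) : Set (Level.suc ℓ) where
  field
    Carrier : Set ℓ
    ev      : Carrier → Maybe (Carrier → Carrier)

data Formula : Set where
  t    : Formula
  _∧_  : Formula → Formula → Formula
  _⇒⊥_ : Formula → Formula → Formula

infixr 6 _∧_
infixr 5 _⇒⊥_

_⇓_ : ∀ {ℓ} {Q : QATS ℓ} → QATS.Carrier Q → (QATS.Carrier Q → QATS.Carrier Q) → Set ℓ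
_⇓_ {Q = Q} a f = QATS.ev Q a ≡ just f

Sat : ∀ {ℓ} (Q : QATS ℓ) → QATS.Carrier Q → Formula → Set ℓ
Sat Q a t         = ⊤
Sat Q a (φ ∧ ψ)   = Sat Q a φ × Sat Q a ψ
Sat Q a (φ ⇒⊥ ψ)  = Σ (QATS.Carrier Q → QATS.Carrier Q) λ f →
                      (_⇓_ {Q = Q} a f) × ((b : QATS.Carrier Q) → Sat Q b φ → Sat Q (f b) ψ)

⊨≤ : (ℓ : Level) → Formula → Formula → Set (Level.suc ℓ)
⊨≤ ℓ φ ψ = (Q : QATS ℓ) (a : QATS.Carrier Q) → Sat Q a φ → Sat Q a ψ

-- The proof system  ⊢ φ ≤ ψ.  (φ = ψ abbreviates both directions; the
-- equational rules are split into their two inequalities.)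
infix 4 ⊢_≤_
data ⊢_≤_ : Formula → Formula → Set where
  refl≤  : ∀ {φ} → ⊢ φ ≤ φ
  trans≤ : ∀ {φ ψ χ} → ⊢ φ ≤ ψ → ⊢ ψ ≤ χ → ⊢ φ ≤ χ
  top    : ∀ {φ} → ⊢ φ ≤ t
  ∧-intro : ∀ {φ ψ χ} → ⊢ χ ≤ φ → ⊢ χ ≤ ψ → ⊢ χ ≤ φ ∧ ψ
  ∧-elimˡ : ∀ {φ ψ} → ⊢ φ ∧ ψ ≤ φ
  ∧-elimʳ : ∀ {φ ψ} → ⊢ φ ∧ ψ ≤ ψ
  ⇒-mono : ∀ {φ₁ φ₂ ψ₁ ψ₂} → ⊢ φ₂ ≤ φ₁ → ⊢ ψ₁ ≤ ψ₂ → ⊢ (φ₁ ⇒⊥ ψ₁) ≤ (φ₂ ⇒⊥ ψ₂)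
  ⇒-∧-dist₁ : ∀ {φ ψ₁ ψ₂} → ⊢ (φ ⇒⊥ (ψ₁ ∧ ψ₂)) ≤ (φ ⇒⊥ ψ₁) ∧ (φ ⇒⊥ ψ₂)
  ⇒-∧-dist₂ : ∀ {φ ψ₁ ψ₂} → ⊢ (φ ⇒⊥ ψ₁) ∧ (φ ⇒⊥ ψ₂) ≤ (φ ⇒⊥ (ψ₁ ∧ ψ₂))
  ⇒-t    : ∀ {φ} → ⊢ (φ ⇒⊥ t) ≤ (t ⇒⊥ t)

module Submission where

-- Fix a quasi-ats Q and read φ ≤ ψ semantically in Q as "every element of Q
-- satisfying φ satisfies ψ" (written φ ⊑ ψ below).  Each rule of ⊢ is shown
-- to preserve ⊑ by its own lemma; all of them are immediate from the
-- definition of satisfaction except distribution of (φ → -)_⊥ over ∧ from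
-- right to left.  There two witnesses f, g of a ⇓ f and a ⇓ g are given and
-- must be merged into one, which is possible because ev is a (partial)
-- function: a ⇓ f and a ⇓ g force f = g.

open import Level using (Level)
open import Defs
open import Data.Product using (_,_; proj₁; proj₂)
open import Data.Maybe.Properties using (just-injective)
open import Relation.Binary.PropositionalEquality using (_≡_; refl; sym; trans)

module Soundness {ℓ : Level} (Q : QATS ℓ) where

  open QATS Q using (Carrier)

  _↓_ : Carrier → (Carrier → Carrier) → Set ℓ
  a ↓ f = _⇓_ {Q = Q} a f

  _⊨_ : Carrier → Formula → Set ℓ
  a ⊨ φ = Sat Q a φ

  _⊑_ : Formula → Formula → Set ℓ
  φ ⊑ ψ = ∀ a → a ⊨ φ → a ⊨ ψ

  infix 4 _⊑_

  ↓-functional : ∀ {a f g} → a ↓ f → a ↓ g → f ≡ g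
  ↓-functional a↓f a↓g = just-injective (trans (sym a↓f) a↓g)

  ⊑-refl : ∀ {φ} → φ ⊑ φ
  ⊑-refl a a⊨φ = a⊨φ

  ⊑-trans : ∀ {φ ψ χ} → φ ⊑ ψ → ψ ⊑ χ → φ ⊑ χ
  ⊑-trans φ⊑ψ ψ⊑χ a a⊨φ = ψ⊑χ a (φ⊑ψ a a⊨φ)

  ⊑-top : ∀ {φ} → φ ⊑ t
  ⊑-top a _ = _

  ⊑-∧-intro : ∀ {φ ψ χ} → χ ⊑ φ → χ ⊑ ψ → χ ⊑ φ ∧ ψ
  ⊑-∧-intro χ⊑φ χ⊑ψ a a⊨χ = χ⊑φ a a⊨χ , χ⊑ψ a a⊨χ

  ⊑-∧-elimˡ : ∀ {φ ψ} → φ ∧ ψ ⊑ φ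
  ⊑-∧-elimˡ a = proj₁

  ⊑-∧-elimʳ : ∀ {φ ψ} → φ ∧ ψ ⊑ ψ
  ⊑-∧-elimʳ a = proj₂

  ⊑-⇒-mono : ∀ {φ₁ φ₂ ψ₁ ψ₂} → φ₂ ⊑ φ₁ → ψ₁ ⊑ ψ₂ → φ₁ ⇒⊥ ψ₁ ⊑ φ₂ ⇒⊥ ψ₂
  ⊑-⇒-mono φ₂⊑φ₁ ψ₁⊑ψ₂ a (f , a↓f , f-maps) =
    f , a↓f , λ b b⊨φ₂ → ψ₁⊑ψ₂ (f b) (f-maps b (φ₂⊑φ₁ b b⊨φ₂))

  ⊑-⇒-∧-split : ∀ {φ ψ₁ ψ₂} → φ ⇒⊥ (ψ₁ ∧ ψ₂) ⊑ (φ ⇒⊥ ψ₁) ∧ (φ ⇒⊥ ψ₂)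
  ⊑-⇒-∧-split a (f , a↓f , f-maps) =
    (f , a↓f , λ b b⊨φ → proj₁ (f-maps b b⊨φ)) ,
    (f , a↓f , λ b b⊨φ → proj₂ (f-maps b b⊨φ))

  ⊑-⇒-∧-merge : ∀ {φ ψ₁ ψ₂} → (φ ⇒⊥ ψ₁) ∧ (φ ⇒⊥ ψ₂) ⊑ φ ⇒⊥ (ψ₁ ∧ ψ₂)
  ⊑-⇒-∧-merge a ((f , a↓f , f-maps₁) , (g , a↓g , g-maps₂))
    with ↓-functional a↓f a↓g
  ... | refl = f , a↓f , λ b b⊨φ → f-maps₁ b b⊨φ , g-maps₂ b b⊨φ

  ⊑-⇒-t : ∀ {φ} → φ ⇒⊥ t ⊑ t ⇒⊥ t
  ⊑-⇒-t a (f , a↓f , _) = f , a↓f , λ _ _ → _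

  sound : ∀ {φ ψ} → ⊢ φ ≤ ψ → φ ⊑ ψ
  sound refl≤         = ⊑-refl
  sound (trans≤ p q)  = ⊑-trans (sound p) (sound q)
  sound top           = ⊑-top
  sound (∧-intro p q) = ⊑-∧-intro (sound p) (sound q)
  sound ∧-elimˡ       = ⊑-∧-elimˡ
  sound ∧-elimʳ       = ⊑-∧-elimʳ
  sound (⇒-mono p q)  = ⊑-⇒-mono (sound p) (sound q)
  sound ⇒-∧-dist₁     = ⊑-⇒-∧-split
  sound ⇒-∧-dist₂     = ⊑-⇒-∧-merge
  sound ⇒-t           = ⊑-⇒-t

mainTheorem16 : ∀ {ℓ : Level} (φ ψ : Formula) → ⊢ φ ≤ ψ → ⊨≤ ℓ φ ψ
mainTheorem16 φ ψ φ≤ψ Q = Soundness.sound Q φ≤ψ
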